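{- There is no odd positive integer $n=\prod_{i=1}^{\omega(n)}p_i^{n_i}$ (with $p_1,\dots,p_{\omega(n)}$ distinct odd primes) such that $n_i\ge 2$ for every $i$, $\sigma(p_i^{n_i})$ is prime for every $i$, and $n$ is a strong alpha number of order $(1,1)$.
   Context: For a positive integer $n$, $\sigma(n)=\sum_{d\mid n} d$ and $\omega(n)$ is the number of distinct prime divisors of $n$. A positive integer $n$ is a strong alpha number of order $(1,1)$ if there exist coprime positive integers $\alpha_1,\alpha_2$ with $\sigma(n)=\frac{\alpha_1}{\alpha_2}n$ and $2\le \max(\alpha_1,\alpha_2)\le \omega(n)$. -}

module Defs where

open import Data.Nat using (ℕ; suc; _*_; _^_; _≤_; _⊔_)
open import Data.Nat.Divisibility using (_∣_; _∣?_)
open import Data.Nat.Primality using (prime?)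
open import Data.Nat.Coprimality using (Coprime)
open import Data.Nat.ListAction using (sum)
open import Data.List using (List; filter; length; map; upTo)
open import Data.Product using (_×_; Σ)
open import Data.Empty using (⊥)
open import Relation.Binary.PropositionalEquality using (_≡_)
open import Relation.Nullary.Decidable using (_×-dec_)

divisors : ℕ → List ℕ
divisors n = filter (λ d → d ∣? n) (map suc (upTo n))

σ : ℕ → ℕ
σ n = sum (divisors n)

ω : ℕ → ℕ
ω n = length (filter (λ p → prime? p ×-dec (p ∣? n)) (map suc (upTo n)))

Odd : ℕ → Set
Odd n = 2 ∣ n → ⊥

-- n is a strong alpha number of order (1,1):
-- ∃ coprime positive α₁ α₂ with σ(n) = (α₁/α₂)·n (i.e. α₂·σ(n) = α₁·n)
-- and 2 ≤ max(α₁,α₂) ≤ ω(n)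
StrongAlpha11 : ℕ → Set
StrongAlpha11 n =
  Σ ℕ λ α₁ → Σ ℕ λ α₂ →
    (1 ≤ α₁) × (1 ≤ α₂) × Coprime α₁ α₂ ×
    (α₂ * σ n ≡ α₁ * n) ×
    (2 ≤ α₁ ⊔ α₂) × (α₁ ⊔ α₂ ≤ ω n)

-- Write n = p₁^k₁ ⋯ pₘ^kₘ.  Since σ is multiplicative, σ(n) = q₁ ⋯ qₘ with every
-- qᵢ = σ(pᵢ^kᵢ) prime, while n, counted with multiplicity, has at least 2m prime
-- factors, each at least 3.  From α₂ σ(n) = α₁ n we get n ∣ α₂ q₁ ⋯ qₘ; each qᵢ
-- can absorb at most one prime factor of n, so 3^(2m) ≤ α₂ 3^m, i.e. 3^m ≤ α₂.
-- But α₂ ≤ ω(n) ≤ m < 3^m.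
module Submission where

open import Defs
open import Data.Nat
open import Data.Nat.Properties
open import Algebra.Properties.CommutativeSemigroup *-commutativeSemigroup using (x∙yz≈y∙xz)
open import Data.Nat.Divisibility
open import Data.Nat.DivMod using (_/_; m*[n/m]≡n)
open import Data.Nat.GCD using (gcd; gcd[m,n]∣m; gcd[m,n]∣n)
open import Data.Nat.Coprimality using (Coprime; coprime-divisor; coprime-/gcd)
import Data.Nat.Coprimality as Coprime
open import Data.Nat.Primality using (Prime; prime?; prime⇒irreducible; prime⇒nonZero; prime⇒nonTrivial)
open import Data.Nat.Primality.Factorisation using (factorisationHasAllPrimeFactors)
open import Data.Nat.ListAction using (sum; product)
open import Data.Nat.ListAction.Properties using (sum-++; sum-↭; product-++; product-↭; product≢0)
open import Data.List using (List; []; _∷_; _++_; map; filter; upTo; length; replicate; cartesianProductWith)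
open import Data.List.Properties using (length-++; length-replicate; length-map)
open import Data.List.Membership.Propositional using (_∈_)
open import Data.List.Membership.Propositional.Properties
  using (∈-map⁺; ∈-map⁻; ∈-filter⁺; ∈-filter⁻; ∈-upTo⁺; ∈-∃++; ∈-cartesianProductWith⁺; ∈-cartesianProductWith⁻)
open import Data.List.Membership.Propositional.Properties.WithK using (unique∧set⇒bag)
open import Data.List.Relation.Binary.Subset.Propositional using (_⊆_)
open import Data.List.Relation.Binary.Permutation.Propositional using (_↭_)
open import Data.List.Relation.Binary.Permutation.Propositional.Properties using (shift; ↭-length; ∈-resp-↭; All-resp-↭)
open import Data.List.Relation.Binary.BagAndSetEquality using (∼bag⇒↭)
open import Data.List.Relation.Unary.All using (All; []; _∷_)
import Data.List.Relation.Unary.All as All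
import Data.List.Relation.Unary.All.Properties as All
open import Data.List.Relation.Unary.Any using (here; there)
open import Data.List.Relation.Unary.AllPairs using ([]; _∷_)
open import Data.List.Relation.Unary.Unique.Propositional using (Unique)
import Data.List.Relation.Unary.Unique.Propositional.Properties as Unique
open import Data.Product using (∃; ∃₂; _×_; _,_; proj₁; proj₂; uncurry)
open import Data.Sum using (inj₁; inj₂)
open import Data.Empty using (⊥)
open import Function using (_∘_; _⇔_; mk⇔)
open import Relation.Binary.PropositionalEquality
open import Relation.Nullary using (¬_; yes; no; contradiction)
open import Relation.Nullary.Decidable using (_×-dec_)
open import Relation.Unary using (Decidable)

private
  variable
    A B C : Set
    xs ys : List A
    a b d e m n o p : ℕ

∈⇒↭∷ : ∀ {v : A} → v ∈ xs → ∃ λ ys → xs ↭ v ∷ ys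
∈⇒↭∷ v∈xs with ys , zs , refl ← ∈-∃++ v∈xs = ys ++ zs , shift _ ys zs

unique∧sameElements⇒↭ : Unique xs → Unique ys → (∀ {v} → v ∈ xs ⇔ v ∈ ys) → xs ↭ ys
unique∧sameElements⇒↭ uxs uys same = ∼bag⇒↭ (unique∧set⇒bag uxs uys same)

unique∧⊆⇒length≤ : Unique xs → xs ⊆ ys → length xs ≤ length ys
unique∧⊆⇒length≤ [] _ = z≤n
unique∧⊆⇒length≤ {xs = x ∷ xs} {ys = ys} (x∉xs ∷ uxs) xxs⊆ys
  with ys′ , ys↭ ← ∈⇒↭∷ (xxs⊆ys (here refl)) = begin
    suc (length xs) ≤⟨ s≤s (unique∧⊆⇒length≤ uxs xs⊆ys′) ⟩
    suc (length ys′) ≡⟨ ↭-length ys↭ ⟨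
    length ys        ∎
  where
  open ≤-Reasoning
  xs⊆ys′ : xs ⊆ ys′
  xs⊆ys′ z∈xs with ∈-resp-↭ ys↭ (xxs⊆ys (there z∈xs))
  ... | here refl = contradiction refl (All.lookup x∉xs z∈xs)
  ... | there z∈ys′ = z∈ys′

Unique-cartesianProductWith : (f : A → B → C) → Unique xs → Unique ys →
  (∀ {x} → x ∈ xs → ∀ {y z} → f x y ≡ f x z → y ≡ z) →
  (∀ {w x y z} → w ∈ xs → x ∈ xs → y ∈ ys → z ∈ ys → f w y ≡ f x z → w ≡ x) →
  Unique (cartesianProductWith f xs ys)
Unique-cartesianProductWith f [] uys injʳ injˡ = []
Unique-cartesianProductWith {xs = x ∷ xs} {ys = ys} f (x∉xs ∷ uxs) uys injʳ injˡ =
  Unique.++⁺ (Unique.map⁺ (injʳ (here refl)) uys)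
             (Unique-cartesianProductWith f uxs uys (injʳ ∘ there) (λ w∈ x∈ → injˡ (there w∈) (there x∈)))
             disjoint
  where
  disjoint : ∀ {v} → ¬ (v ∈ map (f x) ys × v ∈ cartesianProductWith f xs ys)
  disjoint (v∈fxys , v∈fxsys)
    with y , y∈ys , refl ← ∈-map⁻ (f x) v∈fxys
       | x′ , z , x′∈xs , z∈ys , fxy≡fx′z ← ∈-cartesianProductWith⁻ f xs ys v∈fxsys
    = All.lookup x∉xs x′∈xs (injˡ (here refl) (there x′∈xs) y∈ys z∈ys fxy≡fx′z)

sum-map-* : ∀ m ns → sum (map (m *_) ns) ≡ m * sum ns
sum-map-* m [] = sym (*-zeroʳ m)
sum-map-* m (n ∷ ns) = begin
  m * n + sum (map (m *_) ns) ≡⟨ cong (m * n +_) (sum-map-* m ns) ⟩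
  m * n + m * sum ns          ≡⟨ *-distribˡ-+ m n (sum ns) ⟨
  m * (n + sum ns)            ∎
  where open ≡-Reasoning

sum-cartesianProductWith-* : ∀ ms ns → sum (cartesianProductWith _*_ ms ns) ≡ sum ms * sum ns
sum-cartesianProductWith-* [] ns = refl
sum-cartesianProductWith-* (m ∷ ms) ns = begin
  sum (map (m *_) ns ++ cartesianProductWith _*_ ms ns)
    ≡⟨ sum-++ (map (m *_) ns) _ ⟩
  sum (map (m *_) ns) + sum (cartesianProductWith _*_ ms ns)
    ≡⟨ cong₂ _+_ (sum-map-* m ns) (sum-cartesianProductWith-* ms ns) ⟩
  m * sum ns + sum ms * sum ns
    ≡⟨ *-distribʳ-+ (sum ns) m (sum ms) ⟨
  (m + sum ms) * sum ns ∎
  where open ≡-Reasoning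

∣⇒nonZero : .{{NonZero n}} → d ∣ n → NonZero d
∣⇒nonZero {d = zero}  0∣n = contradiction (0∣⇒≡0 0∣n) (≢-nonZero⁻¹ _)
∣⇒nonZero {d = suc _} _   = _

∣-*-split : ∀ a .{{_ : NonZero a}} {b v} → v ∣ a * b → ∃₂ λ d e → d ∣ a × e ∣ b × v ≡ d * e
∣-*-split a {b} {v} v∣ab = g , v / g , gcd[m,n]∣n v a , v/g∣b , sym (m*[n/m]≡n (gcd[m,n]∣m v a))
  where
  g : ℕ
  g = gcd v a
  instance
    g≢0 : NonZero g
    g≢0 = ∣⇒nonZero (gcd[m,n]∣n v a)
  g*[v/g]∣g*[[a/g]*b] : g * (v / g) ∣ g * (a / g * b)
  g*[v/g]∣g*[[a/g]*b] = subst₂ _∣_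
    (sym (m*[n/m]≡n (gcd[m,n]∣m v a)))
    (trans (cong (_* b) (sym (m*[n/m]≡n (gcd[m,n]∣n v a)))) (*-assoc g (a / g) b))
    v∣ab
  v/g∣b : v / g ∣ b
  v/g∣b = coprime-divisor (coprime-/gcd v a) (*-cancelˡ-∣ g g*[v/g]∣g*[[a/g]*b])

coprime-∣ : Coprime a b → d ∣ a → e ∣ b → Coprime d e
coprime-∣ a⊥b d∣a e∣b (i∣d , i∣e) = a⊥b (∣-trans i∣d d∣a , ∣-trans i∣e e∣b)

coprime⇒*-injectiveˡ : ∀ {a b} → Coprime a b → ∀ {d d′ e e′} → d ∣ a → d′ ∣ a → e ∣ b → e′ ∣ b →
  d * e ≡ d′ * e′ → d ≡ d′
coprime⇒*-injectiveˡ {a} {b} a⊥b {d} {d′} {e} {e′} d∣a d′∣a e∣b e′∣b de≡d′e′ =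
  ∣-antisym (divides-left d∣a e′∣b de≡d′e′) (divides-left d′∣a e∣b (sym de≡d′e′))
  where
  divides-left : ∀ {x x′ y y′} → x ∣ a → y′ ∣ b → x * y ≡ x′ * y′ → x ∣ x′
  divides-left {x} {x′} {y} {y′} x∣a y′∣b xy≡x′y′ = coprime-divisor (coprime-∣ a⊥b x∣a y′∣b)
    (subst (x ∣_) (trans xy≡x′y′ (*-comm x′ y′)) (m∣m*n y))

∈-divisors⁻ : d ∈ divisors n → d ∣ n
∈-divisors⁻ {n = n} d∈ = proj₂ (∈-filter⁻ (_∣? n) {xs = map suc (upTo n)} d∈)

∈-divisors⁺ : .{{NonZero n}} → d ∣ n → d ∈ divisors n
∈-divisors⁺ {n = n} {d = zero}  0∣n = contradiction (0∣⇒≡0 0∣n) (≢-nonZero⁻¹ n)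
∈-divisors⁺ {n = n} {d = suc d} d∣n = ∈-filter⁺ (_∣? n) (∈-map⁺ suc (∈-upTo⁺ (∣⇒≤ d∣n))) d∣n

divisors-unique : ∀ n → Unique (divisors n)
divisors-unique n = Unique.filter⁺ (_∣? n) (Unique.map⁺ suc-injective (Unique.upTo⁺ n))

divisors-*-↭ : ∀ a b .{{_ : NonZero a}} .{{_ : NonZero b}} → Coprime a b →
  divisors (a * b) ↭ cartesianProductWith _*_ (divisors a) (divisors b)
divisors-*-↭ a b a⊥b = unique∧sameElements⇒↭ (divisors-unique (a * b)) unique (mk⇔ to from)
  where
  instance
    ab≢0 : NonZero (a * b)
    ab≢0 = m*n≢0 a b
  unique : Unique (cartesianProductWith _*_ (divisors a) (divisors b))
  unique = Unique-cartesianProductWith _*_ (divisors-unique a) (divisors-unique b)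
    (λ d∈ {e} {e′} → *-cancelˡ-≡ e e′ _ {{∣⇒nonZero (∈-divisors⁻ d∈)}})
    (λ d∈ d′∈ e∈ e′∈ → coprime⇒*-injectiveˡ a⊥b
       (∈-divisors⁻ d∈) (∈-divisors⁻ d′∈) (∈-divisors⁻ e∈) (∈-divisors⁻ e′∈))
  to : ∀ {v} → v ∈ divisors (a * b) → v ∈ cartesianProductWith _*_ (divisors a) (divisors b)
  to v∈ with d , e , d∣a , e∣b , refl ← ∣-*-split a (∈-divisors⁻ v∈) =
    ∈-cartesianProductWith⁺ _*_ (∈-divisors⁺ d∣a) (∈-divisors⁺ e∣b)
  from : ∀ {v} → v ∈ cartesianProductWith _*_ (divisors a) (divisors b) → v ∈ divisors (a * b)
  from v∈ with d , e , d∈ , e∈ , refl ← ∈-cartesianProductWith⁻ _*_ (divisors a) (divisors b) v∈ =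
    ∈-divisors⁺ (*-pres-∣ (∈-divisors⁻ {n = a} d∈) (∈-divisors⁻ {n = b} e∈))

σ-* : ∀ a b .{{_ : NonZero a}} .{{_ : NonZero b}} → Coprime a b → σ (a * b) ≡ σ a * σ b
σ-* a b a⊥b = begin
  sum (divisors (a * b))                                        ≡⟨ sum-↭ (divisors-*-↭ a b a⊥b) ⟩
  sum (cartesianProductWith _*_ (divisors a) (divisors b))      ≡⟨ sum-cartesianProductWith-* (divisors a) (divisors b) ⟩
  σ a * σ b                                                     ∎
  where open ≡-Reasoning

prime∤⇒coprime : Prime p → ¬ p ∣ n → Coprime p n
prime∤⇒coprime p-prime p∤n (i∣p , i∣n) with prime⇒irreducible p-prime i∣p
... | inj₁ i≡1 = i≡1
... | inj₂ refl = contradiction i∣n p∤n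

coprime-*ˡ : ∀ {m n o} → Coprime m o → Coprime n o → Coprime (m * n) o
coprime-*ˡ {m} m⊥o n⊥o {i} (i∣mn , i∣o) = n⊥o (coprime-divisor i⊥m i∣mn , i∣o)
  where
  i⊥m : Coprime i m
  i⊥m (j∣i , j∣m) = m⊥o (j∣m , ∣-trans j∣i i∣o)

coprime-^ˡ : ∀ k → Coprime m o → Coprime (m ^ k) o
coprime-^ˡ zero    m⊥o (i∣1 , _) = ∣1⇒≡1 i∣1
coprime-^ˡ (suc k) m⊥o = coprime-*ˡ m⊥o (coprime-^ˡ k m⊥o)

odd-prime⇒3≤ : Prime p → Odd p → 3 ≤ p
odd-prime⇒3≤ {0}                   _       odd = contradiction (2 ∣0) odd
odd-prime⇒3≤ {1}                   1-prime _   = contradiction refl (nonTrivial⇒≢1 {{prime⇒nonTrivial 1-prime}})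
odd-prime⇒3≤ {2}                   _       odd = contradiction ∣-refl odd
odd-prime⇒3≤ {suc (suc (suc _))}   _       _   = s≤s (s≤s (s≤s z≤n))

n<m^n : ∀ {m} → 1 < m → ∀ n → n < m ^ n
n<m^n {m} 1<m zero    = s≤s z≤n
n<m^n {m} 1<m (suc n) = begin-strict
  suc n           ≤⟨ n<m^n 1<m n ⟩
  m ^ n           <⟨ m<m*n (m ^ n) m {{m^n≢0 m n {{>-nonZero (<-trans z<s 1<m)}}}} 1<m ⟩
  m ^ n * m       ≡⟨ *-comm (m ^ n) m ⟩
  m * m ^ n       ∎
  where open ≤-Reasoning

-- Each prime of qs cancels at most one factor of ps; the remaining factors are absorbed by a.
product∣*product⇒^length≤ : ∀ b .{{_ : NonZero b}} a .{{_ : NonZero a}} {ps} qs →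
  All Prime ps → All (b ≤_) ps → All Prime qs →
  product ps ∣ a * product qs → b ^ length ps ≤ a * b ^ length qs
product∣*product⇒^length≤ b a {ps} [] _ b≤ps _ Πps∣a*1 = begin
  b ^ length ps ≤⟨ ^length≤product ps b≤ps ⟩
  product ps    ≤⟨ ∣⇒≤ (subst (product ps ∣_) (*-identityʳ a) Πps∣a*1) ⟩
  a             ≡⟨ *-identityʳ a ⟨
  a * 1         ∎
  where
  open ≤-Reasoning
  ^length≤product : ∀ ps → All (b ≤_) ps → b ^ length ps ≤ product ps
  ^length≤product []       []           = ≤-refl
  ^length≤product (p ∷ ps) (b≤p ∷ b≤ps) = *-mono-≤ b≤p (^length≤product ps b≤ps)
product∣*product⇒^length≤ b a {ps} (q ∷ qs) ps-prime b≤ps (q-prime ∷ qs-prime) Πps∣a*qΠqs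
  with q ∣? product ps
... | yes q∣Πps = cancel (proj₂ (∈⇒↭∷ (factorisationHasAllPrimeFactors q-prime q∣Πps ps-prime)))
  where
  instance
    q≢0 : NonZero q
    q≢0 = prime⇒nonZero q-prime
  open ≤-Reasoning
  cancel : ∀ {ps′} → ps ↭ q ∷ ps′ → b ^ length ps ≤ a * b ^ length (q ∷ qs)
  cancel {ps′} ps↭ = begin
    b ^ length ps            ≡⟨ cong (b ^_) (↭-length ps↭) ⟩
    b * b ^ length ps′       ≤⟨ *-monoʳ-≤ b ih ⟩
    b * (a * b ^ length qs)  ≡⟨ x∙yz≈y∙xz b a _ ⟩
    a * (b * b ^ length qs)  ∎
    where
    ih : b ^ length ps′ ≤ a * b ^ length qs
    ih = product∣*product⇒^length≤ b a qs (All.tail (All-resp-↭ ps↭ ps-prime)) (All.tail (All-resp-↭ ps↭ b≤ps)) qs-prime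
      (*-cancelˡ-∣ q (subst₂ _∣_ (product-↭ ps↭) (x∙yz≈y∙xz a q _) Πps∣a*qΠqs))
... | no q∤Πps = begin
  b ^ length ps            ≤⟨ ih ⟩
  a * b ^ length qs        ≤⟨ *-monoʳ-≤ a (m≤n*m (b ^ length qs) b) ⟩
  a * (b * b ^ length qs)  ∎
  where
  open ≤-Reasoning
  ih : b ^ length ps ≤ a * b ^ length qs
  ih = product∣*product⇒^length≤ b a qs ps-prime b≤ps qs-prime
    (coprime-divisor (Coprime.sym (prime∤⇒coprime q-prime q∤Πps))
      (subst (product ps ∣_) (x∙yz≈y∙xz a q _) Πps∣a*qΠqs))

productOfPowers : List (ℕ × ℕ) → ℕ
productOfPowers fs = product (map (uncurry _^_) fs)

expand : List (ℕ × ℕ) → List ℕ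
expand []             = []
expand ((p , k) ∷ fs) = replicate k p ++ expand fs

product-replicate : ∀ k p → product (replicate k p) ≡ p ^ k
product-replicate zero    p = refl
product-replicate (suc k) p = cong (p *_) (product-replicate k p)

product-expand : ∀ fs → product (expand fs) ≡ productOfPowers fs
product-expand []             = refl
product-expand ((p , k) ∷ fs) = begin
  product (replicate k p ++ expand fs)            ≡⟨ product-++ (replicate k p) (expand fs) ⟩
  product (replicate k p) * product (expand fs)   ≡⟨ cong₂ _*_ (product-replicate k p) (product-expand fs) ⟩
  p ^ k * productOfPowers fs                      ∎
  where open ≡-Reasoning

All-expand : ∀ {P : ℕ → Set} {fs} → All (P ∘ proj₁) fs → All P (expand fs)
All-expand []                         = []
All-expand {fs = (p , k) ∷ _} (Pp ∷ Pfs) = All.++⁺ (All.replicate⁺ k Pp) (All-expand Pfs)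

∈-expand⁻ : ∀ {x} fs → x ∈ expand fs → x ∈ map proj₁ fs
∈-expand⁻ fs = All.lookup (All-expand (All.tabulate (∈-map⁺ proj₁)))

length-expand-≥ : ∀ {c} fs → All ((c ≤_) ∘ proj₂) fs → c * length fs ≤ length (expand fs)
length-expand-≥ {c} []             []           = ≤-reflexive (*-zeroʳ c)
length-expand-≥ {c} ((p , k) ∷ fs) (c≤k ∷ c≤ks) = begin
  c * suc (length fs)                       ≡⟨ *-suc c (length fs) ⟩
  c + c * length fs                         ≤⟨ +-mono-≤ c≤k (length-expand-≥ fs c≤ks) ⟩
  k + length (expand fs)                    ≡⟨ cong (_+ length (expand fs)) (length-replicate k) ⟨
  length (replicate k p) + length (expand fs) ≡⟨ length-++ (replicate k p) ⟨
  length (replicate k p ++ expand fs)       ∎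
  where open ≤-Reasoning

prime∣productOfPowers⇒∈ : ∀ {x fs} → Prime x → All (Prime ∘ proj₁) fs →
  x ∣ productOfPowers fs → x ∈ map proj₁ fs
prime∣productOfPowers⇒∈ {fs = fs} x-prime fs-prime x∣Π = ∈-expand⁻ fs
  (factorisationHasAllPrimeFactors x-prime (subst (_ ∣_) (sym (product-expand fs)) x∣Π) (All-expand fs-prime))

productOfPowers≢0 : ∀ {fs} → All (Prime ∘ proj₁) fs → NonZero (productOfPowers fs)
productOfPowers≢0 {fs} fs-prime =
  subst NonZero (product-expand fs) (product≢0 (All.map prime⇒nonZero (All-expand fs-prime)))

σ-productOfPowers : ∀ {fs} → All (Prime ∘ proj₁) fs → Unique (map proj₁ fs) →
  σ (productOfPowers fs) ≡ product (map (σ ∘ uncurry _^_) fs)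
σ-productOfPowers {[]}           _                   _               = refl
σ-productOfPowers {(p , k) ∷ fs} (p-prime ∷ fs-prime) (p∉fs ∷ distinct) = begin
  σ (p ^ k * productOfPowers fs)    ≡⟨ σ-* (p ^ k) (productOfPowers fs) pᵏ⊥Π ⟩
  σ (p ^ k) * σ (productOfPowers fs) ≡⟨ cong (σ (p ^ k) *_) (σ-productOfPowers fs-prime distinct) ⟩
  σ (p ^ k) * product (map (σ ∘ uncurry _^_) fs) ∎
  where
  open ≡-Reasoning
  instance
    pᵏ≢0 : NonZero (p ^ k)
    pᵏ≢0 = m^n≢0 p k {{prime⇒nonZero p-prime}}
    Π≢0 : NonZero (productOfPowers fs)
    Π≢0 = productOfPowers≢0 fs-prime
  pᵏ⊥Π : Coprime (p ^ k) (productOfPowers fs)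
  pᵏ⊥Π = coprime-^ˡ k (prime∤⇒coprime p-prime
    (λ p∣Π → All.lookup p∉fs (prime∣productOfPowers⇒∈ p-prime fs-prime p∣Π) refl))

ω-productOfPowers≤ : ∀ {fs} → All (Prime ∘ proj₁) fs → ω (productOfPowers fs) ≤ length fs
ω-productOfPowers≤ {fs} fs-prime = subst (ω N ≤_) (length-map proj₁ fs)
  (unique∧⊆⇒length≤ (Unique.filter⁺ primeDivisor? (Unique.map⁺ suc-injective (Unique.upTo⁺ N))) ⊆primes)
  where
  N : ℕ
  N = productOfPowers fs
  primeDivisor? : Decidable (λ q → Prime q × q ∣ N)
  primeDivisor? q = prime? q ×-dec (q ∣? N)
  ⊆primes : filter primeDivisor? (map suc (upTo N)) ⊆ map proj₁ fs
  ⊆primes q∈ with q-prime , q∣n ← proj₂ (∈-filter⁻ primeDivisor? {xs = map suc (upTo N)} q∈) =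
    prime∣productOfPowers⇒∈ q-prime fs-prime q∣n

productOfPowers∣*σ⇒^length≤ : ∀ b .{{_ : NonZero b}} a .{{_ : NonZero a}} {fs} →
  All (Prime ∘ proj₁) fs → All ((b ≤_) ∘ proj₁) fs → All ((2 ≤_) ∘ proj₂) fs →
  All (Prime ∘ σ ∘ uncurry _^_) fs → Unique (map proj₁ fs) →
  productOfPowers fs ∣ a * σ (productOfPowers fs) → b ^ length fs ≤ a
productOfPowers∣*σ⇒^length≤ b a {fs} fs-prime b≤fs 2≤ks σ-prime distinct n∣aσn =
  *-cancelʳ-≤ (b ^ r) a (b ^ r) {{m^n≢0 b r}} (begin
    b ^ r * b ^ r            ≡⟨ ^-distribˡ-+-* b r r ⟨
    b ^ (r + r)              ≡⟨ cong (λ i → b ^ (r + i)) (+-identityʳ r) ⟨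
    b ^ (2 * r)              ≤⟨ ^-monoʳ-≤ b (length-expand-≥ fs 2≤ks) ⟩
    b ^ length (expand fs)   ≤⟨ product∣*product⇒^length≤ b a qs (All-expand fs-prime) (All-expand b≤fs) (All.map⁺ σ-prime) n∣aΠqs ⟩
    a * b ^ length qs        ≡⟨ cong (λ i → a * b ^ i) (length-map _ fs) ⟩
    a * b ^ r                ∎)
  where
  open ≤-Reasoning
  r : ℕ
  r = length fs
  qs : List ℕ
  qs = map (σ ∘ uncurry _^_) fs
  n∣aΠqs : product (expand fs) ∣ a * product qs
  n∣aΠqs = subst₂ _∣_ (sym (product-expand fs)) (cong (a *_) (σ-productOfPowers fs-prime distinct)) n∣aσn

theorem3p4 : (n : ℕ) → 1 ≤ n → Odd n →
    (fs : List (ℕ × ℕ)) →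
    Unique (map proj₁ fs) →
    All (λ { (p , k) → Prime p × Odd p × 2 ≤ k × Prime (σ (p ^ k)) }) fs →
    product (map (λ { (p , k) → p ^ k }) fs) ≡ n →
    StrongAlpha11 n → ⊥
theorem3p4 n _ _ fs distinct conditions Π≡n (α₁ , α₂ , _ , 1≤α₂ , _ , α₂σn≡α₁n , _ , max≤ωn) =
  <-irrefl refl (begin-strict
    r                       <⟨ n<m^n (s≤s (s≤s z≤n)) r ⟩
    3 ^ r                   ≤⟨ productOfPowers∣*σ⇒^length≤ 3 α₂
                                 (All.map proj₁ conditions)
                                 (All.map (λ (p-prime , p-odd , _) → odd-prime⇒3≤ p-prime p-odd) conditions)
                                 (All.map (proj₁ ∘ proj₂ ∘ proj₂) conditions)
                                 (All.map (proj₂ ∘ proj₂ ∘ proj₂) conditions)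
                                 distinct n∣α₂σn ⟩
    α₂                      ≤⟨ m≤n⊔m α₁ α₂ ⟩
    α₁ ⊔ α₂                 ≤⟨ max≤ωn ⟩
    ω n                     ≡⟨ cong ω Π≡n ⟨
    ω (productOfPowers fs)  ≤⟨ ω-productOfPowers≤ (All.map proj₁ conditions) ⟩
    r                       ∎)
  where
  open ≤-Reasoning
  r : ℕ
  r = length fs
  instance
    α₂≢0 : NonZero α₂
    α₂≢0 = >-nonZero 1≤α₂
  n∣α₂σn : productOfPowers fs ∣ α₂ * σ (productOfPowers fs)
  n∣α₂σn = divides α₁ (subst (λ x → α₂ * σ x ≡ α₁ * x) (sym Π≡n) α₂σn≡α₁n)
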